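{- Let $G=(V,E)$ be a graph and let $S$ be an optimal edge-irregulator of $G$. Then for every edge $e\in S$ there exists an edge $uv\in E$ with $d_G(u)=d_G(v)$ such that $e$ is at distance at most $2|S|-1$ from $uv$.
   Context: All graphs are finite and simple; $d_G(x)$ is the degree of $x$ in $G$. A graph is locally irregular if no two adjacent vertices have the same degree. A set $S\subseteq E$ is an edge-irregulator of $G$ if $G-S$ is locally irregular; it is optimal if it has minimum cardinality among edge-irregulators of $G$. The distance between two edges is the minimum distance in $G$ between an endpoint of one and an endpoint of the other. -}

module Defs where

open import Data.Nat using (ℕ; zero; suc; _+_; _*_; _∸_; _≤_)
open import Data.Nat.Base using (_<ᵇ_)
open import Data.Fin using (Fin; toℕ)
open import Data.Bool using (Bool; true; false; _∧_; not; if_then_else_)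
open import Data.List using (List; map; allFin)
open import Data.Nat.ListAction using (sum)
open import Data.Product using (Σ; ∃; _×_; _,_)
open import Data.Sum using (_⊎_)
open import Relation.Binary.PropositionalEquality using (_≡_; _≢_)

record Graph (n : ℕ) : Set where
  field
    adj    : Fin n → Fin n → Bool
    sym    : ∀ i j → adj i j ≡ adj j i
    irrefl : ∀ i → adj i i ≡ false
open Graph public

count : {n : ℕ} → (Fin n → Bool) → ℕ
count {n} f = sum (map (λ x → if f x then 1 else 0) (allFin n))

deg : {n : ℕ} → Graph n → Fin n → ℕ
deg G x = count (adj G x)

record EdgeSet {n : ℕ} (G : Graph n) : Set where
  field
    inS    : Fin n → Fin n → Bool
    symS   : ∀ i j → inS i j ≡ inS j i
    subS   : ∀ i j → inS i j ≡ true → adj G i j ≡ true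
open EdgeSet public

-- |S| : number of unordered pairs {i,j} (counted with i < j) in S
card : {n : ℕ} {G : Graph n} → EdgeSet G → ℕ
card {n} S = sum (map (λ i → count (λ j → inS S i j ∧ (toℕ i <ᵇ toℕ j))) (allFin n))

remove : {n : ℕ} (G : Graph n) → EdgeSet G → Graph n
remove G S = record
  { adj    = λ i j → adj G i j ∧ not (inS S i j)
  ; sym    = λ i j → helper i j
  ; irrefl = λ i → irr i
  }
  where
  open import Relation.Binary.PropositionalEquality using (cong₂)
  helper : ∀ i j → (adj G i j ∧ not (inS S i j)) ≡ (adj G j i ∧ not (inS S j i))
  helper i j = cong₂ (λ a b → a ∧ not b) (Graph.sym G i j) (symS S i j)
  irr : ∀ i → (adj G i i ∧ not (inS S i i)) ≡ false
  irr i rewrite Graph.irrefl G i = Relation.Binary.PropositionalEquality.refl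

LocallyIrregular : {n : ℕ} → Graph n → Set
LocallyIrregular G = ∀ x y → adj G x y ≡ true → deg G x ≢ deg G y

IsEdgeIrregulator : {n : ℕ} (G : Graph n) → EdgeSet G → Set
IsEdgeIrregulator G S = LocallyIrregular (remove G S)

IsOptimalEdgeIrregulator : {n : ℕ} (G : Graph n) → EdgeSet G → Set
IsOptimalEdgeIrregulator G S =
  IsEdgeIrregulator G S × (∀ (S' : EdgeSet G) → IsEdgeIrregulator G S' → card S ≤ card S')

data Walk {n : ℕ} (G : Graph n) : Fin n → Fin n → ℕ → Set where
  here : ∀ x → Walk G x x 0
  step : ∀ {x y z m} → adj G x y ≡ true → Walk G y z m → Walk G x z (suc m)

DistLe : {n : ℕ} → Graph n → Fin n → Fin n → ℕ → Set
DistLe G x y k = ∃ λ m → m ≤ k × Walk G x y m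

EdgeDistLe : {n : ℕ} → Graph n → Fin n → Fin n → Fin n → Fin n → ℕ → Set
EdgeDistLe G a b c d k =
  (DistLe G a c k ⊎ DistLe G a d k) ⊎ (DistLe G b c k ⊎ DistLe G b d k)

{-# OPTIONS --safe #-}
-- Let B r be the set of vertices at distance at most r from the edge ab ∈ S, and
-- S ∩ B r the edges of S meeting B r.  As 1 ≤ |S ∩ B 0| and |S ∩ B r| ≤ |S|, the chain
-- S ∩ B 0 ⊆ S ∩ B 2 ⊆ S ∩ B 4 ⊆ … becomes stationary, S ∩ B (r + 2) = S ∩ B r, for some
-- r ≤ 2|S| − 2.  By optimality S ∖ B r is not an irregulator, so G − (S ∖ B r) has an edge
-- xy with equal end degrees.  If x ∈ B (r + 1), then x, y ∈ B (r + 2) meet no edge of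
-- S ∖ B r by stationarity, so xy is an edge of G with d_G(x) = d_G(y) within distance
-- r + 1 ≤ 2|S| − 1 of ab.  Otherwise x, y ∉ B (r + 1), where S ∖ B r and S contain the
-- same edges at x and at y, contradicting that G − S is locally irregular.
module Submission where

open import Defs
open import Data.Nat using (ℕ; zero; suc; _+_; _*_; _∸_; _≤_; _<_; z≤n; s≤s; _<ᵇ_)
import Data.Nat as ℕ
open import Data.Nat.Properties
  using (≤-refl; ≤-trans; ≤-reflexive; n≤1+n; <-cmp; <⇒≱; <⇒<ᵇ; +-mono-≤; +-mono-<-≤;
         +-mono-≤-<; *-suc; *-monoʳ-≤; ∸-monoˡ-≤)
open import Data.Nat.ListAction using (sum)
open import Data.Fin using (Fin; toℕ)
open import Data.Fin.Properties using (toℕ-injective; any?)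
import Data.Fin.Properties as Fin
open import Data.Bool using (Bool; true; false; _∧_; _∨_; not; if_then_else_)
import Data.Bool.Properties as Bool
open import Data.Bool.Properties using (∨-comm; ∧-identityʳ; ∧-zeroʳ; ¬-not; T-≡)
open import Data.List using ([]; _∷_; map; allFin)
open import Data.List.Properties using (map-cong)
open import Data.List.Relation.Unary.Any using (here; there)
open import Data.List.Membership.Propositional using (_∈_)
open import Data.List.Membership.Propositional.Properties using (∈-allFin)
open import Data.Product using (∃; ∃₂; _×_; _,_)
open import Data.Sum using (_⊎_; inj₁; inj₂)
import Data.Sum as Sum
open import Function.Base using (case_of_)
open import Function.Bundles using (Equivalence)
open import Relation.Nullary using (Dec; yes; no; does; contradiction; _×-dec_)
open import Relation.Nullary.Decidable using (dec-true)
open import Relation.Binary using (tri<; tri≈; tri>)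
open import Relation.Binary.PropositionalEquality using (_≡_; _≢_; refl; trans; cong; cong₂; subst)
import Relation.Binary.PropositionalEquality as ≡

∧-trueˡ : ∀ {x y} → x ∧ y ≡ true → x ≡ true
∧-trueˡ {true} _ = refl

∧-trueʳ : ∀ {x y} → x ∧ y ≡ true → y ≡ true
∧-trueʳ {true} y≡true = y≡true

∧-true : ∀ {x y} → x ≡ true → y ≡ true → x ∧ y ≡ true
∧-true refl refl = refl

∨-trueˡ : ∀ {x} y → x ≡ true → x ∨ y ≡ true
∨-trueˡ _ refl = refl

∨-trueʳ : ∀ x {y} → y ≡ true → x ∨ y ≡ true
∨-trueʳ true  _ = refl
∨-trueʳ false y≡true = y≡true

∨-true⁻ : ∀ x {y} → x ∨ y ≡ true → x ≡ true ⊎ y ≡ true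
∨-true⁻ true  _ = inj₁ refl
∨-true⁻ false y≡true = inj₂ y≡true

true⇒true-contra : ∀ {x y} → (x ≡ true → y ≡ true) → y ≡ false → x ≡ false
true⇒true-contra {false} _ _ = refl
true⇒true-contra {true}  x⇒y y≡false = trans (≡.sym (x⇒y refl)) y≡false

does⇒ : ∀ {A : Set} (a? : Dec A) → does a? ≡ true → A
does⇒ (yes a) _ = a

∃₂? : ∀ {n} {R : Fin n → Fin n → Set} → (∀ x y → Dec (R x y)) → Dec (∃₂ R)
∃₂? R? = any? λ x → any? (R? x)

sum-map-mono : ∀ {A : Set} {f g : A → ℕ} → (∀ x → f x ≤ g x) →
  ∀ xs → sum (map f xs) ≤ sum (map g xs)
sum-map-mono f≤g []       = z≤n
sum-map-mono f≤g (x ∷ xs) = +-mono-≤ (f≤g x) (sum-map-mono f≤g xs)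

sum-map-< : ∀ {A : Set} {f g : A → ℕ} → (∀ x → f x ≤ g x) →
  ∀ {y xs} → y ∈ xs → f y < g y → sum (map f xs) < sum (map g xs)
sum-map-< f≤g {xs = _ ∷ xs} (here refl) fy<gy = +-mono-<-≤ fy<gy (sum-map-mono f≤g xs)
sum-map-< f≤g {xs = x ∷ _}  (there y∈xs) fy<gy = +-mono-≤-< (f≤g x) (sum-map-< f≤g y∈xs fy<gy)

_⊆ᵇ_ : ∀ {A : Set} → (A → Bool) → (A → Bool) → Set
p ⊆ᵇ q = ∀ x → p x ≡ true → q x ≡ true

module _ {n : ℕ} (p q : Fin n → Bool) where

  private
    indicator-mono : ∀ {x y} → (x ≡ true → y ≡ true) → (if x then 1 else 0) ≤ (if y then 1 else 0)
    indicator-mono {false} _   = z≤n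
    indicator-mono {true}  x⇒y rewrite x⇒y refl = ≤-refl

  count-mono : p ⊆ᵇ q → count p ≤ count q
  count-mono p⊆q = sum-map-mono (λ x → indicator-mono (p⊆q x)) (allFin n)

  count-< : p ⊆ᵇ q → ∀ y → p y ≡ false → q y ≡ true → count p < count q
  count-< p⊆q y py qy = sum-map-< (λ x → indicator-mono (p⊆q x)) (∈-allFin y) indicator-<
    where
    indicator-< : (if p y then 1 else 0) < (if q y then 1 else 0)
    indicator-< rewrite py | qy = ≤-refl

  count-cong : (∀ x → p x ≡ q x) → count p ≡ count q
  count-cong p≗q = cong sum (map-cong (λ x → cong (λ b → if b then 1 else 0) (p≗q x)) (allFin n))

adj⇒≢ : ∀ {n} (G : Graph n) {x y} → adj G x y ≡ true → x ≢ y
adj⇒≢ G {x} xy refl = contradiction (trans (≡.sym (irrefl G x)) xy) λ ()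

module _ {n : ℕ} {G : Graph n} where

  _⊆ₑ_ : EdgeSet G → EdgeSet G → Set
  S ⊆ₑ T = ∀ i → inS S i ⊆ᵇ inS T i

  ⊆ₑ-or-witness : (S T : EdgeSet G) → S ⊆ₑ T ⊎ ∃₂ λ i j → inS S i j ≡ true × inS T i j ≡ false
  ⊆ₑ-or-witness S T with ∃₂? (λ i j → (inS S i j Bool.≟ true) ×-dec (inS T i j Bool.≟ false))
  ... | yes witness = inj₂ witness
  ... | no none     = inj₁ λ i j Sij → ¬-not λ Tij → none (i , j , Sij , Tij)

  ∅ₑ : EdgeSet G
  ∅ₑ = record { inS = λ _ _ → false ; symS = λ _ _ → refl ; subS = λ _ _ () }

  restrict : (S : EdgeSet G) (keep : Fin n → Fin n → Bool) →
    (∀ i j → keep i j ≡ keep j i) → EdgeSet G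
  restrict S keep keep-sym = record
    { inS  = λ i j → inS S i j ∧ keep i j
    ; symS = λ i j → cong₂ _∧_ (symS S i j) (keep-sym i j)
    ; subS = λ i j ij → subS S i j (∧-trueˡ ij)
    }

  private
    row : EdgeSet G → Fin n → Fin n → Bool
    row S i j = inS S i j ∧ (toℕ i <ᵇ toℕ j)

    row-mono : ∀ S T → S ⊆ₑ T → ∀ i → row S i ⊆ᵇ row T i
    row-mono S T S⊆T i j ij = ∧-true (S⊆T i j (∧-trueˡ ij)) (∧-trueʳ ij)

  card-mono : ∀ S T → S ⊆ₑ T → card S ≤ card T
  card-mono S T S⊆T =
    sum-map-mono (λ i → count-mono (row S i) (row T i) (row-mono S T S⊆T i)) (allFin n)

  private
    card-<-ordered : ∀ S T {a b} → S ⊆ₑ T → toℕ a < toℕ b →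
      inS S a b ≡ false → inS T a b ≡ true → card S < card T
    card-<-ordered S T {a} {b} S⊆T a<b Sab Tab =
      sum-map-< (λ i → count-mono (row S i) (row T i) (row-mono S T S⊆T i)) (∈-allFin a)
        (count-< (row S a) (row T a) (row-mono S T S⊆T a) b (cong (_∧ (toℕ a <ᵇ toℕ b)) Sab)
          (trans (cong (_∧ (toℕ a <ᵇ toℕ b)) Tab) (Equivalence.to T-≡ (<⇒<ᵇ a<b))))

  card-< : ∀ S T {a b} → S ⊆ₑ T → a ≢ b → inS S a b ≡ false → inS T a b ≡ true →
    card S < card T
  card-< S T {a} {b} S⊆T a≢b Sab Tab with <-cmp (toℕ a) (toℕ b)
  ... | tri< a<b _ _ = card-<-ordered S T S⊆T a<b Sab Tab
  ... | tri≈ _ a≡b _ = contradiction (toℕ-injective a≡b) a≢b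
  ... | tri> _ _ b<a = card-<-ordered S T S⊆T b<a (trans (symS S b a) Sab)
                         (trans (symS T b a) Tab)

module _ {n : ℕ} {G : Graph n} where

  adj-remove-agree : ∀ (S T : EdgeSet G) {w} → (∀ z → inS S w z ≡ inS T w z) →
    ∀ z → adj (remove G S) w z ≡ adj (remove G T) w z
  adj-remove-agree S T {w} S≗T z = cong (λ s → adj G w z ∧ not s) (S≗T z)

  deg-remove-agree : ∀ (S T : EdgeSet G) {w} → (∀ z → inS S w z ≡ inS T w z) →
    deg (remove G S) w ≡ deg (remove G T) w
  deg-remove-agree S T {w} S≗T =
    count-cong (adj (remove G S) w) (adj (remove G T) w) (adj-remove-agree S T S≗T)

deg-remove-∅ : ∀ {n} (G : Graph n) w → deg (remove G ∅ₑ) w ≡ deg G w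
deg-remove-∅ G w = count-cong (adj (remove G ∅ₑ) w) (adj G w) λ z → ∧-identityʳ (adj G w z)

irregular-or-equal-degree-edge : ∀ {n} (G : Graph n) →
  LocallyIrregular G ⊎ ∃₂ λ x y → adj G x y ≡ true × deg G x ≡ deg G y
irregular-or-equal-degree-edge G
  with ∃₂? (λ x y → (adj G x y Bool.≟ true) ×-dec (deg G x ℕ.≟ deg G y))
... | yes witness = inj₂ witness
... | no none     = inj₁ λ x y xy dx≡dy → none (x , y , xy , dx≡dy)

module _ {n : ℕ} {G : Graph n} where

  walk-snoc : ∀ {x y z m} → Walk G x y m → adj G y z ≡ true → Walk G x z (suc m)
  walk-snoc (here _)    yz = step yz (here _)
  walk-snoc (step xw w) yz = step xw (walk-snoc w yz)

  DistLe-mono : ∀ {x y k k′} → k ≤ k′ → DistLe G x y k → DistLe G x y k′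
  DistLe-mono k≤k′ (m , m≤k , w) = m , ≤-trans m≤k k≤k′ , w

  DistLe-snoc : ∀ {x y z k} → DistLe G x y k → adj G y z ≡ true → DistLe G x z (suc k)
  DistLe-snoc (m , m≤k , w) yz = suc m , s≤s m≤k , walk-snoc w yz

  EdgeDistLe-mono : ∀ {a b c d k k′} → k ≤ k′ → EdgeDistLe G a b c d k → EdgeDistLe G a b c d k′
  EdgeDistLe-mono {k = k} {k′} k≤k′ = Sum.map (Sum.map weaken weaken) (Sum.map weaken weaken)
    where
    weaken : ∀ {x y} → DistLe G x y k → DistLe G x y k′
    weaken = DistLe-mono k≤k′

module EdgeBall {n : ℕ} (G : Graph n) (a b : Fin n) where

  ball : ℕ → Fin n → Bool
  ball zero    x = does (x Fin.≟ a) ∨ does (x Fin.≟ b)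
  ball (suc r) x = ball r x ∨ does (any? λ y → ball r y ∧ adj G y x Bool.≟ true)

  a∈ball : ∀ r → ball r a ≡ true
  a∈ball zero    = ∨-trueˡ _ (dec-true (a Fin.≟ a) refl)
  a∈ball (suc r) = ∨-trueˡ _ (a∈ball r)

  ball-⊆-suc : ∀ r → ball r ⊆ᵇ ball (suc r)
  ball-⊆-suc r x = ∨-trueˡ _

  ball-step : ∀ r {x y} → ball r x ≡ true → adj G x y ≡ true → ball (suc r) y ≡ true
  ball-step r {x} {y} x∈ xy = ∨-trueʳ (ball r y) (dec-true (any? _) (x , ∧-true x∈ xy))

  ball-sound : ∀ r x → ball r x ≡ true → DistLe G a x r ⊎ DistLe G b x r
  ball-sound zero x x∈ with ∨-true⁻ (does (x Fin.≟ a)) x∈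
  ... | inj₁ x≟a with refl ← does⇒ (x Fin.≟ a) x≟a = inj₁ (0 , z≤n , here a)
  ... | inj₂ x≟b with refl ← does⇒ (x Fin.≟ b) x≟b = inj₂ (0 , z≤n , here b)
  ball-sound (suc r) x x∈ with ∨-true⁻ (ball r x) x∈
  ... | inj₁ x∈r = Sum.map (DistLe-mono (n≤1+n r)) (DistLe-mono (n≤1+n r)) (ball-sound r x x∈r)
  ... | inj₂ near with y , yx ← does⇒ (any? _) near =
    Sum.map (λ d → DistLe-snoc d (∧-trueʳ yx)) (λ d → DistLe-snoc d (∧-trueʳ yx))
      (ball-sound r y (∧-trueˡ yx))

  touches : ℕ → Fin n → Fin n → Bool
  touches r i j = ball r i ∨ ball r j

  touches-sym : ∀ r i j → touches r i j ≡ touches r j i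
  touches-sym r i j = ∨-comm (ball r i) (ball r j)

  meeting avoiding : EdgeSet G → ℕ → EdgeSet G
  meeting  S r = restrict S (touches r) (touches-sym r)
  avoiding S r = restrict S (λ i j → not (touches r i j)) λ i j → cong not (touches-sym r i j)

  meeting-⊆-suc : ∀ S r → meeting S r ⊆ₑ meeting S (suc r)
  meeting-⊆-suc S r i j ij with ∨-true⁻ (ball r i) (∧-trueʳ ij)
  ... | inj₁ i∈ = ∧-true (∧-trueˡ ij) (∨-trueˡ _ (ball-⊆-suc r i i∈))
  ... | inj₂ j∈ = ∧-true (∧-trueˡ ij) (∨-trueʳ (ball (suc r) i) (ball-⊆-suc r j j∈))

  card-meeting-pos : ∀ S → inS S a b ≡ true → 0 < card (meeting S 0)
  card-meeting-pos S ab∈S =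
    ≤-trans (s≤s z≤n) (card-< ∅ₑ (meeting S 0) (λ _ _ ()) (adj⇒≢ G (subS S a b ab∈S)) refl
      (∧-true ab∈S (∨-trueˡ _ (a∈ball 0))))

  card-avoiding-< : ∀ S r → inS S a b ≡ true → card (avoiding S r) < card S
  card-avoiding-< S r ab∈S =
    card-< (avoiding S r) S (λ _ _ → ∧-trueˡ) (adj⇒≢ G (subS S a b ab∈S)) ab∉ ab∈S
    where
    ab∉ : inS S a b ∧ not (touches r a b) ≡ false
    ab∉ = trans (cong (λ t → inS S a b ∧ not t) (∨-trueˡ _ (a∈ball r))) (∧-zeroʳ (inS S a b))

  Stationary : EdgeSet G → ℕ → Set
  Stationary S r = meeting S (2 + r) ⊆ₑ meeting S r

  stationary-or-meeting-grows : ∀ S → inS S a b ≡ true →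
    ∀ j → (∃ λ r → 2 + r ≤ 2 * j × Stationary S r) ⊎ j < card (meeting S (2 * j))
  stationary-or-meeting-grows S ab∈S zero = inj₂ (card-meeting-pos S ab∈S)
  stationary-or-meeting-grows S ab∈S (suc j) with stationary-or-meeting-grows S ab∈S j
  ... | inj₁ (r , 2+r≤2j , stationary) =
    inj₁ (r , ≤-trans 2+r≤2j (*-monoʳ-≤ 2 (n≤1+n j)) , stationary)
  ... | inj₂ j<card with ⊆ₑ-or-witness (meeting S (2 + 2 * j)) (meeting S (2 * j))
  ...   | inj₁ stationary = inj₁ (2 * j , ≤-reflexive (≡.sym (*-suc 2 j)) , stationary)
  ...   | inj₂ (i , k , ik∈ , ik∉) =
    inj₂ (subst (λ r → suc j < card (meeting S r)) (≡.sym (*-suc 2 j))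
      (≤-trans (s≤s j<card)
        (card-< (meeting S (2 * j)) (meeting S (2 + 2 * j)) meeting-⊆-2+
          (adj⇒≢ G (subS S i k (∧-trueˡ ik∈))) ik∉ ik∈)))
    where
    meeting-⊆-2+ : meeting S (2 * j) ⊆ₑ meeting S (2 + 2 * j)
    meeting-⊆-2+ x y xy = meeting-⊆-suc S (suc (2 * j)) x y (meeting-⊆-suc S (2 * j) x y xy)

  stationary-radius : ∀ S → inS S a b ≡ true → ∃ λ r → 2 + r ≤ 2 * card S × Stationary S r
  stationary-radius S ab∈S with stationary-or-meeting-grows S ab∈S (card S)
  ... | inj₁ found = found
  ... | inj₂ |S|<card =
    contradiction (card-mono (meeting S (2 * card S)) S (λ _ _ → ∧-trueˡ)) (<⇒≱ |S|<card)

  module _ (S : EdgeSet G) (r : ℕ) (stationary : Stationary S r) where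

    avoiding-empty-inside : ∀ {w} → ball (2 + r) w ≡ true →
      ∀ z → inS (avoiding S r) w z ≡ false
    avoiding-empty-inside {w} w∈ z with inS S w z in wz
    ... | false = refl
    ... | true  = cong not (∧-trueʳ (stationary w z (∧-true wz (∨-trueˡ _ w∈))))

    avoiding-agrees-outside : ∀ {w} → ball (suc r) w ≡ false →
      ∀ z → inS (avoiding S r) w z ≡ inS S w z
    avoiding-agrees-outside {w} w∉ z with inS S w z in wz
    ... | false = refl
    ... | true  = cong not (cong₂ _∨_ w∉r z∉r)
      where
      w∉r : ball r w ≡ false
      w∉r = true⇒true-contra (ball-⊆-suc r w) w∉
      z∉r : ball r z ≡ false
      z∉r = true⇒true-contra (λ z∈ → ball-step r z∈ (trans (sym G z w) (subS S w z wz))) w∉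

    private
      G′ : Graph n
      G′ = remove G (avoiding S r)

    equal-degree-edge-inside : ∀ {x y} → ball (suc r) x ≡ true →
      adj G′ x y ≡ true → deg G′ x ≡ deg G′ y →
      adj G x y ≡ true × deg G x ≡ deg G y × EdgeDistLe G a b x y (suc r)
    equal-degree-edge-inside {x} {y} x∈ xy′ dx≡dy =
      xy , dx≡dy-in-G , Sum.map inj₁ inj₁ (ball-sound (suc r) x x∈)
      where
      xy : adj G x y ≡ true
      xy = ∧-trueˡ xy′
      deg-inside : ∀ {w} → ball (2 + r) w ≡ true → deg G′ w ≡ deg G w
      deg-inside w∈ =
        trans (deg-remove-agree (avoiding S r) ∅ₑ (avoiding-empty-inside w∈)) (deg-remove-∅ G _)
      dx≡dy-in-G : deg G x ≡ deg G y
      dx≡dy-in-G = begin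
        deg G x  ≡⟨ deg-inside (ball-⊆-suc (suc r) x x∈) ⟨
        deg G′ x ≡⟨ dx≡dy ⟩
        deg G′ y ≡⟨ deg-inside (ball-step (suc r) x∈ xy) ⟩
        deg G y  ∎
        where open ≡.≡-Reasoning

    no-equal-degree-edge-outside : IsEdgeIrregulator G S → ∀ {x y} →
      ball (suc r) x ≡ false → ball (suc r) y ≡ false → adj G′ x y ≡ true → deg G′ x ≢ deg G′ y
    no-equal-degree-edge-outside irregular {x} {y} x∉ y∉ xy′ dx≡dy =
      irregular x y (trans (≡.sym (adj-remove-agree (avoiding S r) S x-agrees y)) xy′)
        (begin
          deg (remove G S) x ≡⟨ deg-remove-agree (avoiding S r) S x-agrees ⟨
          deg G′ x           ≡⟨ dx≡dy ⟩
          deg G′ y           ≡⟨ deg-remove-agree (avoiding S r) S y-agrees ⟩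
          deg (remove G S) y ∎)
      where
      open ≡.≡-Reasoning
      x-agrees : ∀ z → inS (avoiding S r) x z ≡ inS S x z
      x-agrees = avoiding-agrees-outside x∉
      y-agrees : ∀ z → inS (avoiding S r) y z ≡ inS S y z
      y-agrees = avoiding-agrees-outside y∉

    equal-degree-edge-near-ab : IsEdgeIrregulator G S → ∀ {x y} →
      adj G′ x y ≡ true → deg G′ x ≡ deg G′ y →
      ∃₂ λ u v → adj G u v ≡ true × deg G u ≡ deg G v × EdgeDistLe G a b u v (suc r)
    equal-degree-edge-near-ab irregular {x} {y} xy dx≡dy
      with ball (suc r) x in x∈? | ball (suc r) y in y∈?
    ... | true  | _     = x , y , equal-degree-edge-inside x∈? xy dx≡dy
    ... | false | true  = y , x , equal-degree-edge-inside y∈? (trans (sym G′ y x) xy) (≡.sym dx≡dy)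
    ... | false | false = contradiction dx≡dy (no-equal-degree-edge-outside irregular x∈? y∈? xy)

lemma1 : ∀ {n : ℕ} (G : Graph n) (S : EdgeSet G) → IsOptimalEdgeIrregulator G S →
    ∀ (a b : Fin n) → inS S a b ≡ true →
    ∃ λ (u : Fin n) → ∃ λ (v : Fin n) →
      adj G u v ≡ true × deg G u ≡ deg G v × EdgeDistLe G a b u v (2 * card S ∸ 1)
lemma1 G S (irregular , optimal) a b ab∈S =
  let r , 2+r≤2|S| , stationary = stationary-radius S ab∈S in
  case irregular-or-equal-degree-edge (remove G (avoiding S r)) of λ where
    (inj₁ irregular′) →
      contradiction (optimal (avoiding S r) irregular′) (<⇒≱ (card-avoiding-< S r ab∈S))
    (inj₂ (x , y , xy , dx≡dy)) →
      let u , v , uv , du≡dv , near = equal-degree-edge-near-ab S r stationary irregular xy dx≡dy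
      in  u , v , uv , du≡dv , EdgeDistLe-mono (∸-monoˡ-≤ 1 2+r≤2|S|) near
  where open EdgeBall G a b
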